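{- The following two functions are weakly derivable (for all list types $\Sigma,\Gamma$): split $\Sigma^*\to(\Sigma^*\times\Sigma^*)^*$, mapping $[a_1,\ldots,a_n]$ to the list $[([\,],[a_1,\ldots,a_n]),([a_1],[a_2,\ldots,a_n]),\ldots,([a_1,\ldots,a_n],[\,])]$ of all (prefix, suffix) decompositions; and block $(\Sigma+\Gamma)^*\to(\Sigma^*+\Gamma^*)^*$, which groups the input list into maximal blocks of consecutive elements from the same side (e.g. $[1,2,a,3,4,5,b,c]\mapsto[[1,2],[a],[3,4,5],[b,c]]$ when numbers are in $\Sigma$ and letters in $\Gamma$).
   Context: List types are generated by $1$, $\times$, $+$ (tagged disjoint union) and $*$; graded list types also allow $!$, which does not change underlying sets; the grade of a type is the maximal nesting of $!$. Strongly derivable functions are derived from the primes: commutativity and associativity of $\times$ and $+$; distributivity $\Gamma\times(\Sigma+\Delta)\leftrightarrow(\Gamma\times\Sigma)+(\Gamma\times\Delta)$; projections; co-projections; co-diagonal; append $\Sigma^*\times\Sigma\to\Sigma^*$; reverse; concat $\Sigma^{**}\to\Sigma^*$; create empty $\Sigma\to\Sigma\times\Gamma^*$; list distribute $(\Sigma\times\Gamma)^*\to\Sigma^*\times\Gamma^*$; $!(\Gamma+\Sigma)\leftrightarrow!\Gamma+!\Sigma$; $!(\Gamma\times\Sigma)\leftrightarrow!\Gamma\times!\Sigma$; $(!\Gamma)^*\leftrightarrow!(\Gamma^*)$; absorption $!\Gamma\to!\Gamma\times\Gamma$, $!x\mapsto(!x,x)$; with combinators composition, functoriality of $\times,+,*,!$,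 and safe fold: from $g:!^k1\to\Gamma$ and $\delta:\Gamma\times\Sigma\to\Gamma$ obtain $!^k(\Sigma^*)\to\Gamma$, $[a_1,\ldots,a_n]\mapsto b_n$ with $b_0$ the value of $g$ and $b_i=\delta(b_{i-1},a_i)$, allowed only if the grade of $\Gamma$ is $<k$. A function $f:\Sigma\to\Gamma$ is weakly derivable if some strongly derivable $!^k\Sigma\to\Gamma$ equals $f$ on underlying sets. -}

module Defs where

open import Data.Nat using (ℕ; zero; suc; _<_; _⊔_)
open import Data.Unit using (⊤; tt)
open import Data.Product using (_×_; _,_; proj₁; proj₂; ∃-syntax)
open import Data.Sum using (_⊎_; inj₁; inj₂; [_,_])
open import Data.List using (List; []; _∷_; _++_; [_]; map; reverse; concat; foldl; take; drop; length; upTo; unzip)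
open import Relation.Binary.PropositionalEquality using (_≡_)

infixr 6 _⊕_
infixr 7 _⊗_
infix 8 _✶
infix 9 !_

-- Graded list types: generated by 1, ×, + (tagged disjoint union), * and !.
-- (Ungraded) list types are exactly those of grade 0, i.e. containing no !.
data Ty : Set where
  𝟙   : Ty
  _⊗_ : Ty → Ty → Ty
  _⊕_ : Ty → Ty → Ty
  _✶  : Ty → Ty
  !_  : Ty → Ty

grade : Ty → ℕ
grade 𝟙       = 0
grade (A ⊗ B) = grade A ⊔ grade B
grade (A ⊕ B) = grade A ⊔ grade B
grade (A ✶)   = grade A
grade (! A)   = suc (grade A)

⟦_⟧ : Ty → Set
⟦ 𝟙 ⟧     = ⊤
⟦ A ⊗ B ⟧ = ⟦ A ⟧ × ⟦ B ⟧
⟦ A ⊕ B ⟧ = ⟦ A ⟧ ⊎ ⟦ B ⟧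
⟦ A ✶ ⟧   = List ⟦ A ⟧
⟦ ! A ⟧   = ⟦ A ⟧

bangs : ℕ → Ty → Ty
bangs zero    A = A
bangs (suc k) A = ! bangs k A

up : ∀ k A → ⟦ A ⟧ → ⟦ bangs k A ⟧
up zero    A x = x
up (suc k) A x = up k A x

down : ∀ k A → ⟦ bangs k A ⟧ → ⟦ A ⟧
down zero    A x = x
down (suc k) A x = down k A x

-- Strongly derivable functions: derivations built from the primes and combinators.
data Der : Ty → Ty → Set where
  comm⊗   : ∀ {A B} → Der (A ⊗ B) (B ⊗ A)
  comm⊕   : ∀ {A B} → Der (A ⊕ B) (B ⊕ A)
  assoc⊗  : ∀ {A B C} → Der ((A ⊗ B) ⊗ C) (A ⊗ (B ⊗ C))
  assoc⊗⁻ : ∀ {A B C} → Der (A ⊗ (B ⊗ C)) ((A ⊗ B) ⊗ C)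
  assoc⊕  : ∀ {A B C} → Der ((A ⊕ B) ⊕ C) (A ⊕ (B ⊕ C))
  assoc⊕⁻ : ∀ {A B C} → Der (A ⊕ (B ⊕ C)) ((A ⊕ B) ⊕ C)
  distr   : ∀ {A B C} → Der (A ⊗ (B ⊕ C)) ((A ⊗ B) ⊕ (A ⊗ C))
  distr⁻  : ∀ {A B C} → Der ((A ⊗ B) ⊕ (A ⊗ C)) (A ⊗ (B ⊕ C))
  proj₁D  : ∀ {A B} → Der (A ⊗ B) A
  proj₂D  : ∀ {A B} → Der (A ⊗ B) B
  inj₁D   : ∀ {A B} → Der A (A ⊕ B)
  inj₂D   : ∀ {A B} → Der B (A ⊕ B)
  codiag  : ∀ {A} → Der (A ⊕ A) A
  append  : ∀ {A} → Der (A ✶ ⊗ A) (A ✶)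
  rev     : ∀ {A} → Der (A ✶) (A ✶)
  conc    : ∀ {A} → Der (A ✶ ✶) (A ✶)
  empty   : ∀ {A B} → Der A (A ⊗ B ✶)
  ldistr  : ∀ {A B} → Der ((A ⊗ B) ✶) (A ✶ ⊗ B ✶)
  !⊕      : ∀ {A B} → Der (! (A ⊕ B)) (! A ⊕ ! B)
  !⊕⁻     : ∀ {A B} → Der (! A ⊕ ! B) (! (A ⊕ B))
  !⊗      : ∀ {A B} → Der (! (A ⊗ B)) (! A ⊗ ! B)
  !⊗⁻     : ∀ {A B} → Der (! A ⊗ ! B) (! (A ⊗ B))
  !✶      : ∀ {A} → Der ((! A) ✶) (! (A ✶))
  !✶⁻     : ∀ {A} → Der (! (A ✶)) ((! A) ✶)
  absorb  : ∀ {A} → Der (! A) (! A ⊗ A)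
  _∘D_    : ∀ {A B C} → Der B C → Der A B → Der A C
  _⊗D_    : ∀ {A B C D} → Der A B → Der C D → Der (A ⊗ C) (B ⊗ D)
  _⊕D_    : ∀ {A B C D} → Der A B → Der C D → Der (A ⊕ C) (B ⊕ D)
  mapD    : ∀ {A B} → Der A B → Der (A ✶) (B ✶)
  !D      : ∀ {A B} → Der A B → Der (! A) (! B)
  fold    : ∀ {k S G} → grade G < k → Der (bangs k 𝟙) G → Der (G ⊗ S) G
          → Der (bangs k (S ✶)) G

eval : ∀ {A B} → Der A B → ⟦ A ⟧ → ⟦ B ⟧
eval comm⊗ (x , y) = y , x
eval comm⊕ (inj₁ x) = inj₂ x
eval comm⊕ (inj₂ y) = inj₁ y
eval assoc⊗ ((x , y) , z) = x , (y , z)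
eval assoc⊗⁻ (x , (y , z)) = (x , y) , z
eval assoc⊕ (inj₁ (inj₁ x)) = inj₁ x
eval assoc⊕ (inj₁ (inj₂ y)) = inj₂ (inj₁ y)
eval assoc⊕ (inj₂ z) = inj₂ (inj₂ z)
eval assoc⊕⁻ (inj₁ x) = inj₁ (inj₁ x)
eval assoc⊕⁻ (inj₂ (inj₁ y)) = inj₁ (inj₂ y)
eval assoc⊕⁻ (inj₂ (inj₂ z)) = inj₂ z
eval distr (x , inj₁ y) = inj₁ (x , y)
eval distr (x , inj₂ z) = inj₂ (x , z)
eval distr⁻ (inj₁ (x , y)) = x , inj₁ y
eval distr⁻ (inj₂ (x , z)) = x , inj₂ z
eval proj₁D (x , y) = x
eval proj₂D (x , y) = y
eval inj₁D x = inj₁ x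
eval inj₂D y = inj₂ y
eval codiag (inj₁ x) = x
eval codiag (inj₂ x) = x
eval append (xs , x) = xs ++ [ x ]
eval rev xs = reverse xs
eval conc xss = concat xss
eval empty x = x , []
eval ldistr xs = unzip xs
eval !⊕ x = x
eval !⊕⁻ x = x
eval !⊗ x = x
eval !⊗⁻ x = x
eval !✶ x = x
eval !✶⁻ x = x
eval absorb x = x , x
eval (f ∘D g) x = eval f (eval g x)
eval (f ⊗D g) (x , y) = eval f x , eval g y
eval (f ⊕D g) (inj₁ x) = inj₁ (eval f x)
eval (f ⊕D g) (inj₂ y) = inj₂ (eval g y)
eval (mapD f) xs = map (eval f) xs
eval (!D f) x = eval f x
eval (fold {k} {S} {G} _ g δ) xs =
  foldl (λ b a → eval δ (b , a)) (eval g (up k 𝟙 tt)) (down k (S ✶) xs)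

WeaklyDerivable : (A B : Ty) → (⟦ A ⟧ → ⟦ B ⟧) → Set
WeaklyDerivable A B f = ∃[ k ] ∃[ d ] (∀ (x : ⟦ A ⟧) → eval {bangs k A} {B} d (up k A x) ≡ f x)

split : (S : Ty) → ⟦ S ✶ ⟧ → ⟦ (S ✶ ⊗ S ✶) ✶ ⟧
split S xs = map (λ i → take i xs , drop i xs) (upTo (suc (length xs)))

consBlock : ∀ {X Y : Set} → X ⊎ Y → List (List X ⊎ List Y) → List (List X ⊎ List Y)
consBlock (inj₁ a) (inj₁ as ∷ r) = inj₁ (a ∷ as) ∷ r
consBlock (inj₁ a) r             = inj₁ (a ∷ []) ∷ r
consBlock (inj₂ b) (inj₂ bs ∷ r) = inj₂ (b ∷ bs) ∷ r
consBlock (inj₂ b) r             = inj₂ (b ∷ []) ∷ r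

blockL : ∀ {X Y : Set} → List (X ⊎ Y) → List (List X ⊎ List Y)
blockL []       = []
blockL (x ∷ xs) = consBlock x (blockL xs)

block : (S G : Ty) → ⟦ (S ⊕ G) ✶ ⟧ → ⟦ (S ✶ ⊕ G ✶) ✶ ⟧
block S G = blockL

-- Both functions are computed by safe folds. A fold is run over the reversed
-- input, so that its step prepends, which is what the recursive definitions do.
--
-- For block, the state is the list of blocks seen so far with its first block
-- held apart (or absent): the step can then compare the side of the new element
-- with the side of the current block, and on this view it is exactly consBlock.
--
-- For split, a first fold annotates each element a with the suffix starting at a.
-- A second fold runs through the annotated list from left to right, keeping the
-- prefix read so far in a !-component; absorption duplicates it, one copy to be
-- extended and one to be emitted paired with the current suffix. Each fold needs
-- a state of grade 1 and hence its input under !!, and the first fold also uses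
-- each element twice, which accounts for the six !s.
module Submission where

open import Defs
open import Data.Nat using (ℕ; zero; suc; _<_; s≤s; z≤n)
open import Data.Unit using (⊤; tt)
open import Data.Product using (_×_; _,_; proj₂; map₁)
open import Data.Sum using (_⊎_; inj₁; inj₂)
open import Data.List using (List; []; _∷_; _++_; [_]; map; reverse; foldl; foldr; take; drop; length; applyUpTo; upTo)
open import Data.List.Properties
  using (reverse-++; reverse-involutive; reverse-foldl; ++-assoc; ++-identityʳ; map-cong; map-∘; map-id; map-applyUpTo)
open import Function using (_∘_)
open import Relation.Binary.PropositionalEquality using (_≡_; refl; sym; trans; cong; cong₂)
open Relation.Binary.PropositionalEquality.≡-Reasoning

infixl 4 _⨾_

_⨾_ : ∀ {A B C} → Der A B → Der B C → Der A C
f ⨾ g = g ∘D f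

idD : ∀ {A} → Der A A
idD {A} = empty {A} {𝟙} ⨾ proj₁D

derelict : ∀ {A} → Der (! A) A
derelict = absorb ⨾ proj₂D

!ⁿD : ∀ k {A B} → Der A B → Der (bangs k A) (bangs k B)
!ⁿD zero    f = f
!ⁿD (suc k) f = !D (!ⁿD k f)

interchange : ∀ {A B C D} → Der ((A ⊗ B) ⊗ (C ⊗ D)) ((A ⊗ C) ⊗ (B ⊗ D))
interchange = assoc⊗ ⨾ idD ⊗D (assoc⊗⁻ ⨾ comm⊗ ⊗D idD ⨾ assoc⊗) ⨾ assoc⊗⁻

caseˡ : ∀ {P Q A T} → Der (P ⊗ A) T → Der (Q ⊗ A) T → Der ((P ⊕ Q) ⊗ A) T
caseˡ f g = comm⊗ ⨾ distr ⨾ (comm⊗ ⨾ f) ⊕D (comm⊗ ⨾ g) ⨾ codiag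

nil : ∀ {A B} → Der A (B ✶)
nil = empty ⨾ proj₂D

singleton : ∀ {A} → Der A (A ✶)
singleton {A} = empty {A} {A} ⨾ comm⊗ ⨾ append

cons : ∀ {A} → Der (A ⊗ A ✶) (A ✶)
cons = comm⊗ ⨾ rev ⊗D idD ⨾ append ⨾ rev

eval-cons : ∀ {A} (x : ⟦ A ⟧) xs → eval (cons {A}) (x , xs) ≡ x ∷ xs
eval-cons x xs = trans (reverse-++ (reverse xs) [ x ]) (cong (x ∷_) (reverse-involutive xs))

eval-!ⁿD : ∀ k {A B} (f : Der A B) x → eval (!ⁿD k f) (up k A x) ≡ up k B (eval f x)
eval-!ⁿD zero    f x = refl
eval-!ⁿD (suc k) f x = eval-!ⁿD k f x

down-up : ∀ k A (x : ⟦ A ⟧) → down k A (up k A x) ≡ x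
down-up zero    A x = refl
down-up (suc k) A x = down-up k A x

foldrD : ∀ {k A G} → grade G < k → Der (bangs k 𝟙) G → Der (G ⊗ A) G → Der (bangs k (A ✶)) G
foldrD {k} lt g δ = !ⁿD k rev ⨾ fold lt g δ

eval-foldrD : ∀ {k A G} (lt : grade G < k) g (δ : Der (G ⊗ A) G) xs →
  eval (foldrD lt g δ) (up k (A ✶) xs) ≡ foldr (λ a b → eval δ (b , a)) (eval g (up k 𝟙 tt)) xs
eval-foldrD {k} {A} lt g δ xs = begin
  foldl step b (down k (A ✶) (eval (!ⁿD k rev) (up k (A ✶) xs)))
    ≡⟨ cong (λ ys → foldl step b (down k (A ✶) ys)) (eval-!ⁿD k rev xs) ⟩
  foldl step b (down k (A ✶) (up k (A ✶) (reverse xs)))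
    ≡⟨ cong (foldl step b) (down-up k (A ✶) (reverse xs)) ⟩
  foldl step b (reverse xs)
    ≡⟨ reverse-foldl step b xs ⟩
  foldr (λ a c → eval δ (c , a)) b xs ∎
  where
  step = λ c a → eval δ (c , a)
  b = eval g (up k 𝟙 tt)

viewHead : ∀ {A : Set} → List A → (⊤ ⊎ A) × List A
viewHead []       = inj₁ tt , []
viewHead (x ∷ xs) = inj₂ x , xs

module BlockDerivation (S G : Ty) (flatS : grade S ≡ 0) (flatG : grade G ≡ 0) where

  Block : Ty
  Block = S ✶ ⊕ G ✶

  Blocks : Ty
  Blocks = Block ✶

  State : Ty
  State = (𝟙 ⊕ Block) ⊗ Blocks

  State-grade : grade State < 1
  State-grade rewrite flatS | flatG = s≤s z≤n

  openBlock : Der (𝟙 ⊗ (Blocks ⊗ (S ⊕ G))) State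
  openBlock = proj₂D ⨾ comm⊗ ⨾ (singleton ⊕D singleton ⨾ inj₂D) ⊗D idD

  sameSide : ∀ {A} → Der (A ✶) Block → Der (A ⊗ (A ✶ ⊗ Blocks)) State
  sameSide tag = assoc⊗⁻ ⨾ (cons ⨾ tag ⨾ inj₂D) ⊗D idD

  otherSide : ∀ {A C} → Der (A ✶) Block → Der (C ✶) Block → Der (C ⊗ (A ✶ ⊗ Blocks)) State
  otherSide tagA tagC = (singleton ⨾ tagC ⨾ inj₂D) ⊗D (tagA ⊗D idD ⨾ cons)

  extendS : Der (S ✶ ⊗ (Blocks ⊗ (S ⊕ G))) State
  extendS = assoc⊗⁻ ⨾ comm⊗ ⨾ caseˡ (sameSide inj₁D) (otherSide inj₁D inj₂D)

  extendG : Der (G ✶ ⊗ (Blocks ⊗ (S ⊕ G))) State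
  extendG = assoc⊗⁻ ⨾ comm⊗ ⨾ caseˡ (otherSide inj₂D inj₁D) (sameSide inj₂D)

  blockStep : Der (State ⊗ (S ⊕ G)) State
  blockStep = assoc⊗ ⨾ caseˡ openBlock (caseˡ extendS extendG)

  blockStep-viewHead : ∀ (r : ⟦ Blocks ⟧) x → eval blockStep (viewHead r , x) ≡ viewHead (consBlock x r)
  blockStep-viewHead []             (inj₁ a) = refl
  blockStep-viewHead []             (inj₂ c) = refl
  blockStep-viewHead (inj₁ as ∷ r) (inj₁ a) = cong (λ bs → inj₂ (inj₁ bs) , r) (eval-cons {S} a as)
  blockStep-viewHead (inj₁ as ∷ r) (inj₂ c) = cong (inj₂ (inj₂ [ c ]) ,_) (eval-cons {Block} (inj₁ as) r)
  blockStep-viewHead (inj₂ cs ∷ r) (inj₁ a) = cong (inj₂ (inj₁ [ a ]) ,_) (eval-cons {Block} (inj₂ cs) r)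
  blockStep-viewHead (inj₂ cs ∷ r) (inj₂ c) = cong (λ bs → inj₂ (inj₂ bs) , r) (eval-cons {G} c cs)

  blockStep-foldr : ∀ xs → foldr (λ x st → eval blockStep (st , x)) (viewHead []) xs ≡ viewHead (blockL xs)
  blockStep-foldr []       = refl
  blockStep-foldr (x ∷ xs) =
    trans (cong (λ st → eval blockStep (st , x)) (blockStep-foldr xs)) (blockStep-viewHead (blockL xs) x)

  blocksOf : Der State Blocks
  blocksOf = caseˡ proj₂D cons

  blocksOf-viewHead : ∀ (r : ⟦ Blocks ⟧) → eval blocksOf (viewHead r) ≡ r
  blocksOf-viewHead []      = refl
  blocksOf-viewHead (b ∷ r) = eval-cons {Block} b r

  emptyState : Der (! 𝟙) State
  emptyState = derelict ⨾ inj₁D ⨾ empty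

  blockD : Der (! ((S ⊕ G) ✶)) Blocks
  blockD = foldrD State-grade emptyState blockStep ⨾ blocksOf

  blockD-correct : ∀ xs → eval blockD xs ≡ block S G xs
  blockD-correct xs = begin
    eval blockD xs
      ≡⟨ cong (eval blocksOf) (eval-foldrD State-grade emptyState blockStep xs) ⟩
    eval blocksOf (foldr (λ x st → eval blockStep (st , x)) (viewHead []) xs)
      ≡⟨ cong (eval blocksOf) (blockStep-foldr xs) ⟩
    eval blocksOf (viewHead (blockL xs))
      ≡⟨ blocksOf-viewHead (blockL xs) ⟩
    blockL xs ∎

withTails : ∀ {A : Set} → List A → List (A × List A)
withTails []       = []
withTails (a ∷ as) = (a , a ∷ as) ∷ withTails as

module SplitDerivation (S : Ty) (flat : grade S ≡ 0) where

  split-∷ : ∀ a (L : ⟦ S ✶ ⟧) → split S (a ∷ L) ≡ ([] , a ∷ L) ∷ map (map₁ (a ∷_)) (split S L)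
  split-∷ a L = cong (([] , a ∷ L) ∷_) (begin
    map (splitAt (a ∷ L)) (applyUpTo suc (suc n))
      ≡⟨ map-applyUpTo suc (splitAt (a ∷ L)) (suc n) ⟩
    applyUpTo (map₁ (a ∷_) ∘ splitAt L) (suc n)
      ≡⟨ sym (map-applyUpTo (λ i → i) (map₁ (a ∷_) ∘ splitAt L) (suc n)) ⟩
    map (map₁ (a ∷_) ∘ splitAt L) (upTo (suc n))
      ≡⟨ map-∘ (upTo (suc n)) ⟩
    map (map₁ (a ∷_)) (split S L) ∎)
    where
    n = length L
    splitAt : ⟦ S ✶ ⟧ → ℕ → ⟦ S ✶ ⊗ S ✶ ⟧
    splitAt xs i = take i xs , drop i xs

  Annotated : Ty
  Annotated = (! S ⊗ S ✶) ✶

  Splits : Ty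
  Splits = (S ✶ ⊗ S ✶) ✶

  suffix-grade : grade (! (S ✶) ⊗ Annotated) < 2
  suffix-grade rewrite flat = s≤s (s≤s z≤n)

  prefix-grade : grade (! (S ✶) ⊗ Splits) < 2
  prefix-grade rewrite flat = s≤s (s≤s z≤n)

  start : ∀ {B} → Der (bangs 2 𝟙) (! (S ✶) ⊗ B ✶)
  start = derelict ⨾ !D nil ⨾ empty

  suffixStep : Der ((! (S ✶) ⊗ Annotated) ⊗ bangs 2 S) (! (S ✶) ⊗ Annotated)
  suffixStep =
    idD ⊗D (absorb ⨾ derelict ⊗D idD) ⨾ interchange ⨾ comm⊗ ⊗D comm⊗
    ⨾ (!⊗⁻ ⨾ !D cons ⨾ absorb) ⊗D idD ⨾ assoc⊗ ⨾ idD ⊗D (assoc⊗⁻ ⨾ comm⊗ ⊗D idD ⨾ cons)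

  suffixStep-spec : ∀ s V a → eval suffixStep ((s , V) , a) ≡ (a ∷ s , (a , a ∷ s) ∷ V)
  suffixStep-spec s V a rewrite eval-cons {S} a s = cong (a ∷ s ,_) (eval-cons {(! S) ⊗ S ✶} (a , a ∷ s) V)

  suffixStep-foldr : ∀ L → foldr (λ a b → eval suffixStep (b , a)) ([] , []) L ≡ (L , withTails L)
  suffixStep-foldr []      = refl
  suffixStep-foldr (a ∷ L) =
    trans (cong (λ b → eval suffixStep (b , a)) (suffixStep-foldr L)) (suffixStep-spec L (withTails L) a)

  prefixStep : Der ((! (S ✶) ⊗ Splits) ⊗ (! S ⊗ S ✶)) (! (S ✶) ⊗ Splits)
  prefixStep =
    (absorb ⊗D idD) ⊗D idD ⨾ assoc⊗ ⊗D idD ⨾ interchange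
    ⨾ (!⊗⁻ ⨾ !D append) ⊗D (comm⊗ ⊗D idD ⨾ assoc⊗ ⨾ append)

  prefixStep-spec : ∀ p O a t → eval prefixStep ((p , O) , (a , t)) ≡ (p ++ [ a ] , O ++ [ (p , t) ])
  prefixStep-spec p O a t = refl

  closeSplits : Der (! (S ✶) ⊗ Splits) Splits
  closeSplits = comm⊗ ⨾ idD ⊗D (derelict ⨾ empty) ⨾ append

  prefixStep-foldl : ∀ p O L →
    eval closeSplits (foldl (λ b e → eval prefixStep (b , e)) (p , O) (withTails L))
      ≡ O ++ map (map₁ (p ++_)) (split S L)
  prefixStep-foldl p O []      = cong (λ q → O ++ [ (q , []) ]) (sym (++-identityʳ p))
  prefixStep-foldl p O (a ∷ L) = begin
    close (foldl step (eval prefixStep ((p , O) , (a , a ∷ L))) (withTails L))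
      ≡⟨ cong (λ st → close (foldl step st (withTails L))) (prefixStep-spec p O a (a ∷ L)) ⟩
    close (foldl step (p ++ [ a ] , O ++ [ (p , a ∷ L) ]) (withTails L))
      ≡⟨ prefixStep-foldl (p ++ [ a ]) (O ++ [ (p , a ∷ L) ]) L ⟩
    (O ++ [ (p , a ∷ L) ]) ++ map (map₁ ((p ++ [ a ]) ++_)) (split S L)
      ≡⟨ ++-assoc O _ _ ⟩
    O ++ ((p , a ∷ L) ∷ map (map₁ ((p ++ [ a ]) ++_)) (split S L))
      ≡⟨ cong₂ (λ q M → O ++ ((q , a ∷ L) ∷ M)) (sym (++-identityʳ p)) extend-prefix ⟩
    O ++ map (map₁ (p ++_)) (([] , a ∷ L) ∷ map (map₁ (a ∷_)) (split S L))
      ≡⟨ cong (λ M → O ++ map (map₁ (p ++_)) M) (sym (split-∷ a L)) ⟩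
    O ++ map (map₁ (p ++_)) (split S (a ∷ L)) ∎
    where
    step = λ b e → eval prefixStep (b , e)
    close = eval closeSplits
    extend-prefix : map (map₁ ((p ++ [ a ]) ++_)) (split S L)
                  ≡ map (map₁ (p ++_)) (map (map₁ (a ∷_)) (split S L))
    extend-prefix = trans (map-cong (λ (u , v) → cong (_, v) (++-assoc p [ a ] u)) (split S L))
                          (map-∘ (split S L))

  splitD : Der (bangs 6 (S ✶)) Splits
  splitD =
    !ⁿD 2 (!ⁿD 2 (!D !✶⁻ ⨾ !✶⁻) ⨾ foldrD suffix-grade start suffixStep ⨾ proj₂D)
    ⨾ fold prefix-grade start prefixStep ⨾ closeSplits

  splitD-correct : ∀ L → eval splitD L ≡ split S L
  splitD-correct L = begin
    eval splitD L
      ≡⟨ cong (run ∘ proj₂) (eval-foldrD suffix-grade start suffixStep L) ⟩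
    run (proj₂ (foldr (λ a b → eval suffixStep (b , a)) ([] , []) L))
      ≡⟨ cong (run ∘ proj₂) (suffixStep-foldr L) ⟩
    run (withTails L)
      ≡⟨ prefixStep-foldl [] [] L ⟩
    map (map₁ ([] ++_)) (split S L)
      ≡⟨ map-id (split S L) ⟩
    split S L ∎
    where
    run = λ V → eval closeSplits (foldl (λ b e → eval prefixStep (b , e)) ([] , []) V)

lemma4 : (S G : Ty) → grade S ≡ 0 → grade G ≡ 0
    → WeaklyDerivable (S ✶) ((S ✶ ⊗ S ✶) ✶) (split S)
      × WeaklyDerivable ((S ⊕ G) ✶) ((S ✶ ⊕ G ✶) ✶) (block S G)
lemma4 S G flatS flatG =
  (6 , splitD , splitD-correct) , (1 , blockD , blockD-correct)
  where
  open SplitDerivation S flatS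
  open BlockDerivation S G flatS flatG
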